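{- Let $\mathcal{B}$ be a connected building set on $[n]$ which is invariant under the involution $\omega:[n]\to[n]$, $\omega(i)=n-i+1$ (i.e. $\omega(I)\in\mathcal{B}$ for all $I\in\mathcal{B}$). Then \[ h_{\mathcal{B}}(t,q,u)=t^{n-1}h_{\mathcal{B}}(t^{ -1},q^{ -1},qu). \]
   Context: A building set on $[n]$ is a collection $\mathcal{B}$ of nonempty subsets of $[n]$ closed under unions of intersecting members and containing all singletons; it is connected if $[n]\in\mathcal{B}$. For a rooted tree $T$ on $[n]$ and a vertex $i$, $T_{\le i}$ is the set of $i$ and its descendants. A $\mathcal{B}$-tree is a rooted tree $T$ on $[n]$ with $T_{\le i}\in\mathcal{B}$ for all $i$, and $\bigcup_{j=1}^k T_{\le i_j}\notin\mathcal{B}$ for any $k\ge2$ pairwise incomparable nodes $i_1,\ldots,i_k$. Write $x\lessdot_T y$ if $\{x,y\}$ is an edge of $T$ with $y$ closer to the root. $\mathrm{Des}(T)=\{(i,j): i\lessdot_T j,\ i>j\}$, $\mathrm{des}(T)=|\mathrm{Des}(T)|$; $\mathrm{dp}(x)$ is the length of the path from $x$ to the root, $\mathrm{depth}(T)=\max_x\mathrm{dp}(x)$, $\mathrm{maj}(T)=\sum_{(i,j)\in\mathrm{Des}(T)}(\mathrm{depth}(T)-\mathrm{dp}(j))$, and $\mu(T)=\sum_{i\lessdot_T j}(\mathrm{depth}(T)-\mathrm{dp}(j))$ (sum over all edges). Define $h_{\mathcal{B}}(t,q,u)=\sum_T t^{\mathrm{des}(T)}q^{\mathrm{maj}(T)}u^{\mu(T)}$,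 the sum over all $\mathcal{B}$-trees $T$. -}

module Defs where

open import Level using (Level; 0ℓ)
open import Data.Nat as ℕ using (ℕ; zero; suc; _∸_; _⊔_; _≤_)
open import Data.Fin as Fin using (Fin; opposite)
open import Data.Fin.Subset as Sub using (Subset; ⁅_⁆; ⊤; _∩_; _∪_; Nonempty; ∣_∣)
open import Data.Maybe using (Maybe; just; nothing; maybe; _>>=_)
open import Data.Vec using (Vec; lookup; tabulate)
open import Data.List using (List; []; _∷_; map; allFin; foldr)
open import Data.Bool using (if_then_else_)
open import Data.Product using (Σ-syntax; ∃-syntax; _×_)
open import Relation.Binary.PropositionalEquality using (_≡_)
open import Relation.Nullary using (¬_)
open import Relation.Nullary.Decidable using (⌊_⌋)
open import Function.Bundles using (_⇔_)
open import Algebra.Bundles using (CommutativeRing)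

-- Building sets on [n], encoded as Fin n (vertex i ↔ Fin.toℕ i + 1).
-- A collection of subsets is a predicate on Subset n.

IsBuildingSet : ∀ {n} → (Subset n → Set) → Set
IsBuildingSet {n} B =
    (∀ I → B I → Nonempty I)
  × (∀ (i : Fin n) → B ⁅ i ⁆)
  × (∀ I J → B I → B J → Nonempty (I ∩ J) → B (I ∪ J))

IsConnected : ∀ {n} → (Subset n → Set) → Set
IsConnected B = B ⊤

-- ω(i) = n - i + 1 ; on 0-based Fin n this is `opposite` (i ↦ n-1-i).
-- ω(I) = { ω(i) : i ∈ I }, i.e. j ∈ ω(I) iff ω(j) ∈ I.
ωset : ∀ {n} → Subset n → Subset n
ωset I = tabulate (λ j → lookup I (opposite j))

IsωInvariant : ∀ {n} → (Subset n → Set) → Set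
IsωInvariant B = ∀ I → B I → B (ωset I)

-- Rooted trees on [n], encoded by their parent vector:
-- lookup p i ≡ just j  means  i ⋖_T j ; lookup p i ≡ nothing means i is the root.

Parent : ℕ → Set
Parent n = Vec (Maybe (Fin n)) n

anc : ∀ {n} → Parent n → ℕ → Fin n → Maybe (Fin n)
anc p zero    i = just i
anc p (suc k) i = anc p k i >>= lookup p

-- j ≤_T i : j is i or a descendant of i  (j ∈ T_{≤ i})
_⊑[_]_ : ∀ {n} → Fin n → Parent n → Fin n → Set
j ⊑[ p ] i = ∃[ k ] anc p k j ≡ just i

IsRootedTree : ∀ {n} → Parent n → Set
IsRootedTree {n} p =
  Σ[ r ∈ Fin n ] (lookup p r ≡ nothing)
               × (∀ i → lookup p i ≡ nothing → i ≡ r)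
               × (∀ i → i ⊑[ p ] r)

IsBTree : ∀ {n} → (Subset n → Set) → Parent n → Set
IsBTree {n} B p =
    IsRootedTree p
  × (∀ (i : Fin n) (S : Subset n) → (∀ j → (j Sub.∈ S) ⇔ (j ⊑[ p ] i)) → B S)
  × (∀ (K S : Subset n) → 2 ≤ ∣ K ∣
       → (∀ a b → a Sub.∈ K → b Sub.∈ K → a ⊑[ p ] b → a ≡ b)
       → (∀ x → (x Sub.∈ S) ⇔ (∃[ a ] (a Sub.∈ K × x ⊑[ p ] a)))
       → ¬ B S)

-- number of parent-steps to the root (fuel n suffices for a tree on [n])
steps : ∀ {n} → ℕ → Parent n → Fin n → ℕ
steps zero    p i = 0
steps (suc f) p i = maybe (λ j → suc (steps f p j)) 0 (lookup p i)

dp : ∀ {n} → Parent n → Fin n → ℕ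
dp {n} p i = steps n p i

depth : ∀ {n} → Parent n → ℕ
depth {n} p = foldr _⊔_ 0 (map (dp p) (allFin n))

sumℕ : List ℕ → ℕ
sumℕ = foldr ℕ._+_ 0

edgeSum : ∀ {n} → Parent n → (Fin n → Fin n → ℕ) → ℕ
edgeSum {n} p f = sumℕ (map (λ i → maybe (λ j → f i j) 0 (lookup p i)) (allFin n))

isDes : ∀ {n} → Fin n → Fin n → ℕ
isDes i j = if ⌊ j Fin.<? i ⌋ then 1 else 0

des : ∀ {n} → Parent n → ℕ
des p = edgeSum p isDes

maj : ∀ {n} → Parent n → ℕ
maj p = edgeSum p (λ i j → isDes i j ℕ.* (depth p ∸ dp p j))

μ : ∀ {n} → Parent n → ℕ
μ p = edgeSum p (λ i j → depth p ∸ dp p j)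

module _ {c ℓ : Level} (R : CommutativeRing c ℓ) where
  open CommutativeRing R

  pow : Carrier → ℕ → Carrier
  pow x zero    = 1#
  pow x (suc k) = x * pow x k

  hSum : ∀ {n} → List (Parent n) → Carrier → Carrier → Carrier → Carrier
  hSum []       t q u = 0#
  hSum (T ∷ Ts) t q u = pow t (des T) * pow q (maj T) * pow u (μ T) + hSum Ts t q u

-- Relabelling a tree by ω (i ↦ n + 1 − i) maps B-trees to B-trees because B is ω-invariant, and it
-- is an involution, so it permutes the B-trees. Since ω reverses the order of labels, every edge of T
-- is a descent in exactly one of T and ω(T), while depths are unchanged; hence
-- des T + des ω(T) = n − 1, μ ω(T) = μ T and maj T + maj ω(T) = μ T. So the monomial
-- t^des q^maj u^μ of T is t^(n−1) times the monomial of ω(T) at (t⁻¹, q⁻¹, q u), and summing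
-- over the permutation T ↦ ω(T) gives the identity.

module Submission where

open import Defs
open import Level using (Level)
open import Algebra.Bundles using (CommutativeMonoid; CommutativeRing)
import Algebra.Properties.CommutativeSemigroup as CommutativeSemigroupProperties
import Algebra.Properties.CommutativeSemiring.Exp as Exp
open import Data.Bool using (true; false; if_then_else_)
open import Data.Empty using (⊥-elim)
open import Data.Fin as Fin using (Fin; opposite)
import Data.Fin.Properties as Finₚ
open import Data.Fin.Subset as Sub using (Subset)
open import Data.List using (List; []; _∷_; map; allFin; foldr)
import Data.List.Properties as Listₚ
open import Data.List.Membership.Propositional using (_∈_)
import Data.List.Membership.Propositional.Properties as Membershipₚ
open import Data.List.Membership.Propositional.Properties.WithK using (unique∧set⇒bag)
open import Data.List.Relation.Binary.BagAndSetEquality using (∼bag⇒↭)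
open import Data.List.Relation.Binary.Permutation.Propositional using (_↭_; ↭⇒↭ₛ′)
import Data.List.Relation.Binary.Permutation.Propositional.Properties as Permutationₚ
import Data.List.Relation.Binary.Permutation.Setoid.Properties as SetoidPermutationₚ
open import Data.List.Relation.Unary.All as All using (All; []; _∷_)
open import Data.List.Relation.Unary.Unique.Propositional using (Unique)
import Data.List.Relation.Unary.Unique.Propositional.Properties as Uniqueₚ
open import Data.Maybe as Maybe using (Maybe; just; nothing; maybe′)
import Data.Maybe.Properties as Maybeₚ
open import Data.Nat as ℕ using (ℕ; zero; suc; _+_; _∸_; _≤_)
import Data.Nat.Properties as ℕₚ
open import Data.Product using (∃-syntax; _×_; _,_; proj₁)
open import Data.Vec as Vec using (lookup; tabulate)
import Data.Vec.Properties as Vecₚ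
open import Function using (_∘_; id)
open import Function.Bundles using (_⇔_; mk⇔; Equivalence)
import Function.Properties.Equivalence as ⇔
open import Relation.Binary.Definitions using (tri<; tri≈; tri>)
open import Relation.Binary.PropositionalEquality
  using (_≡_; _≢_; refl; sym; trans; cong; cong₂; subst; subst₂; module ≡-Reasoning)
open import Relation.Nullary using (yes; no; ¬_)

private variable n : ℕ

unique∧set⇒↭ : ∀ {a} {A : Set a} {xs ys : List A} → Unique xs → Unique ys
  → (∀ {x} → x ∈ xs ⇔ x ∈ ys) → xs ↭ ys
unique∧set⇒↭ xs! ys! same = ∼bag⇒↭ (unique∧set⇒bag xs! ys! same)

opposite-injective : ∀ {i j : Fin n} → opposite i ≡ opposite j → i ≡ j
opposite-injective {i = i} {j} eq =
  trans (sym (Finₚ.opposite-involutive i)) (trans (cong opposite eq) (Finₚ.opposite-involutive j))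

map-opposite-allFin : ∀ n → map opposite (allFin n) ↭ allFin n
map-opposite-allFin n = unique∧set⇒↭ (Uniqueₚ.map⁺ opposite-injective (Uniqueₚ.allFin⁺ n)) (Uniqueₚ.allFin⁺ n)
  (mk⇔ (λ _ → Membershipₚ.∈-allFin _) opposite-∈)
  where
  opposite-∈ : ∀ {i} → i ∈ allFin n → i ∈ map opposite (allFin n)
  opposite-∈ {i} _ = subst (_∈ map opposite (allFin n)) (Finₚ.opposite-involutive i)
    (Membershipₚ.∈-map⁺ opposite (Membershipₚ.∈-allFin (opposite i)))

module Fold {c ℓ} (M : CommutativeMonoid c ℓ) where
  open CommutativeMonoid M
    renaming (sym to ≈-sym; trans to ≈-trans; setoid to ≈-setoid)
  open CommutativeSemigroupProperties commutativeSemigroup using (interchange)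
  open import Relation.Binary.Reasoning.Setoid ≈-setoid

  foldr-↭ : ∀ {xs ys} → xs ↭ ys → foldr _∙_ ε xs ≈ foldr _∙_ ε ys
  foldr-↭ xs↭ys =
    SetoidPermutationₚ.foldr-commMonoid ≈-setoid isCommutativeMonoid (↭⇒↭ₛ′ isEquivalence xs↭ys)

  fold : (Fin n → Carrier) → Carrier
  fold {n} f = foldr _∙_ ε (map f (allFin n))

  fold-cong : {f g : Fin n → Carrier} → (∀ i → f i ≡ g i) → fold f ≡ fold g
  fold-cong {n} f≗g = cong (foldr _∙_ ε) (Listₚ.map-cong f≗g (allFin n))

  fold-suc : (f : Fin (suc n) → Carrier) → fold f ≡ f Fin.zero ∙ fold (f ∘ Fin.suc)
  fold-suc {n} f = cong (λ xs → f Fin.zero ∙ foldr _∙_ ε xs)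
    (trans (Listₚ.map-tabulate Fin.suc f) (sym (Listₚ.map-tabulate id (f ∘ Fin.suc))))

  fold-opposite : (f : Fin n → Carrier) → fold (f ∘ opposite) ≈ fold f
  fold-opposite {n} f = begin
    foldr _∙_ ε (map (f ∘ opposite) (allFin n))   ≡⟨ cong (foldr _∙_ ε) (Listₚ.map-∘ (allFin n)) ⟩
    foldr _∙_ ε (map f (map opposite (allFin n))) ≈⟨ foldr-↭ (Permutationₚ.map⁺ f (map-opposite-allFin n)) ⟩
    fold f                                        ∎

  fold-∙ : (f g : Fin n → Carrier) → fold (λ i → f i ∙ g i) ≈ fold f ∙ fold g
  fold-∙ {n} f g = foldr-map-∙ (allFin n)
    where
    foldr-map-∙ : ∀ is → foldr _∙_ ε (map (λ i → f i ∙ g i) is) ≈ foldr _∙_ ε (map f is) ∙ foldr _∙_ ε (map g is)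
    foldr-map-∙ []       = ≈-sym (identityˡ ε)
    foldr-map-∙ (i ∷ is) = ≈-trans (∙-congˡ (foldr-map-∙ is)) (interchange (f i) (g i) _ _)

open Fold ℕₚ.+-0-commutativeMonoid using ()
  renaming (fold to ∑; fold-cong to ∑-cong; fold-suc to ∑-suc; fold-opposite to ∑-opposite; fold-∙ to ∑-+)
open Fold ℕₚ.⊔-0-commutativeMonoid using ()
  renaming (fold-cong to max-cong; fold-opposite to max-opposite)

∑-ones : (g : Fin n → ℕ) → (∀ i → g i ≡ 1) → ∑ g ≡ n
∑-ones {zero}  g ones = refl
∑-ones {suc n} g ones = trans (∑-suc g) (cong₂ _+_ (ones Fin.zero) (∑-ones (g ∘ Fin.suc) (ones ∘ Fin.suc)))

∑-ones-but-one : (g : Fin (suc n) → ℕ) (r : Fin (suc n)) → g r ≡ 0 → (∀ i → i ≢ r → g i ≡ 1) → ∑ g ≡ n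
∑-ones-but-one g Fin.zero zero-at-r ones = trans (∑-suc g)
  (cong₂ _+_ zero-at-r (∑-ones (g ∘ Fin.suc) (λ i → ones (Fin.suc i) (λ ()))))
∑-ones-but-one {suc n} g (Fin.suc r) zero-at-r ones = trans (∑-suc g)
  (cong₂ _+_ (ones Fin.zero (λ ()))
    (∑-ones-but-one (g ∘ Fin.suc) r zero-at-r (λ i i≢r → ones (Fin.suc i) (i≢r ∘ Finₚ.suc-injective))))

indicator : Subset n → Fin n → ℕ
indicator p i = if lookup p i then 1 else 0

∣p∣≡∑ : (p : Subset n) → Sub.∣ p ∣ ≡ ∑ (indicator p)
∣p∣≡∑ Vec.[]              = refl
∣p∣≡∑ p@(true Vec.∷ p′)  = trans (cong suc (∣p∣≡∑ p′)) (sym (∑-suc (indicator p)))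
∣p∣≡∑ p@(false Vec.∷ p′) = trans (∣p∣≡∑ p′) (sym (∑-suc (indicator p)))

lookup-ωset : (I : Subset n) (i : Fin n) → lookup (ωset I) i ≡ lookup I (opposite i)
lookup-ωset I = Vecₚ.lookup∘tabulate (lookup I ∘ opposite)

∈-ωset : {I : Subset n} {i : Fin n} → i Sub.∈ ωset I ⇔ opposite i Sub.∈ I
∈-ωset {I = I} {i} = mk⇔
  (λ i∈ → Vecₚ.lookup⇒[]= (opposite i) I (trans (sym (lookup-ωset I i)) (Vecₚ.[]=⇒lookup i∈)))
  (λ i∈ → Vecₚ.lookup⇒[]= i (ωset I) (trans (lookup-ωset I i) (Vecₚ.[]=⇒lookup i∈)))

ωset-involutive : (I : Subset n) → ωset (ωset I) ≡ I
ωset-involutive I = trans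
  (Vecₚ.tabulate-cong (λ i → trans (lookup-ωset I (opposite i)) (cong (lookup I) (Finₚ.opposite-involutive i))))
  (Vecₚ.tabulate∘lookup I)

∣ωset∣ : (I : Subset n) → Sub.∣ ωset I ∣ ≡ Sub.∣ I ∣
∣ωset∣ I = begin
  Sub.∣ ωset I ∣             ≡⟨ ∣p∣≡∑ (ωset I) ⟩
  ∑ (indicator (ωset I))     ≡⟨ ∑-cong (λ i → cong (λ b → if b then 1 else 0) (lookup-ωset I i)) ⟩
  ∑ (indicator I ∘ opposite) ≡⟨ ∑-opposite (indicator I) ⟩
  ∑ (indicator I)            ≡⟨ ∣p∣≡∑ I ⟨
  Sub.∣ I ∣                  ∎
  where open ≡-Reasoning

ωtree : Parent n → Parent n
ωtree p = tabulate (λ i → Maybe.map opposite (lookup p (opposite i)))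

lookup-ωtree : (p : Parent n) (i : Fin n) → lookup (ωtree p) (opposite i) ≡ Maybe.map opposite (lookup p i)
lookup-ωtree p i = trans (Vecₚ.lookup∘tabulate _ (opposite i))
  (cong (Maybe.map opposite ∘ lookup p) (Finₚ.opposite-involutive i))

ωtree-involutive : (p : Parent n) → ωtree (ωtree p) ≡ p
ωtree-involutive p = trans (Vecₚ.tabulate-cong λ i → begin
    Maybe.map opposite (lookup (ωtree p) (opposite i))     ≡⟨ cong (Maybe.map opposite) (lookup-ωtree p i) ⟩
    Maybe.map opposite (Maybe.map opposite (lookup p i))   ≡⟨ Maybeₚ.map-∘ (lookup p i) ⟨
    Maybe.map (opposite ∘ opposite) (lookup p i)           ≡⟨ Maybeₚ.map-cong Finₚ.opposite-involutive (lookup p i) ⟩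
    Maybe.map id (lookup p i)                              ≡⟨ Maybeₚ.map-id (lookup p i) ⟩
    lookup p i                                             ∎)
  (Vecₚ.tabulate∘lookup p)
  where open ≡-Reasoning

ωtree-injective : {p p′ : Parent n} → ωtree p ≡ ωtree p′ → p ≡ p′
ωtree-injective {p = p} {p′} eq = trans (sym (ωtree-involutive p)) (trans (cong ωtree eq) (ωtree-involutive p′))

anc-ωtree : (p : Parent n) (k : ℕ) (i : Fin n) → anc (ωtree p) k (opposite i) ≡ Maybe.map opposite (anc p k i)
anc-ωtree p zero    i = refl
anc-ωtree p (suc k) i with anc p k i | anc-ωtree p k i
... | nothing | ih = cong (Maybe._>>= lookup (ωtree p)) ih
... | just a  | ih = trans (cong (Maybe._>>= lookup (ωtree p)) ih) (lookup-ωtree p a)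

⊑-ωtree : {p : Parent n} {i j : Fin n} → j ⊑[ p ] i ⇔ opposite j ⊑[ ωtree p ] opposite i
⊑-ωtree {p = p} {i} {j} = mk⇔
  (λ (k , eq) → k , trans (anc-ωtree p k j) (cong (Maybe.map opposite) eq))
  (λ (k , eq) → k , Maybeₚ.map-injective opposite-injective (trans (sym (anc-ωtree p k j)) eq))

∀-opposite : ∀ {ℓ} {P : Fin n → Set ℓ} → (∀ i → P (opposite i)) → ∀ i → P i
∀-opposite {P = P} h i = subst P (Finₚ.opposite-involutive i) (h (opposite i))

∃-opposite : ∀ {ℓ} {P : Fin n → Set ℓ} → ∃[ i ] P i → ∃[ i ] P (opposite i)
∃-opposite {P = P} (i , Pi) = opposite i , subst P (sym (Finₚ.opposite-involutive i)) Pi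

IsSubtreeOf : Parent n → Fin n → Subset n → Set
IsSubtreeOf p i S = ∀ j → (j Sub.∈ S) ⇔ (j ⊑[ p ] i)

IsAntichain : Parent n → Subset n → Set
IsAntichain p K = ∀ a b → a Sub.∈ K → b Sub.∈ K → a ⊑[ p ] b → a ≡ b

IsSubtreeUnion : Parent n → Subset n → Subset n → Set
IsSubtreeUnion p K S = ∀ x → (x Sub.∈ S) ⇔ (∃[ a ] (a Sub.∈ K × x ⊑[ p ] a))

IsRootedTree-ωtree : {p : Parent n} → IsRootedTree p → IsRootedTree (ωtree p)
IsRootedTree-ωtree {p = p} (r , root , unique-root , reaches-root) =
  opposite r , root′ , ∀-opposite unique-root′ , ∀-opposite (λ i → Equivalence.to ⊑-ωtree (reaches-root i))
  where
  root′ : lookup (ωtree p) (opposite r) ≡ nothing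
  root′ = trans (lookup-ωtree p r) (cong (Maybe.map opposite) root)
  unique-root′ : ∀ i → lookup (ωtree p) (opposite i) ≡ nothing → opposite i ≡ opposite r
  unique-root′ i is-root = cong opposite (unique-root i
    (Maybeₚ.map-injective opposite-injective (trans (sym (lookup-ωtree p i)) is-root)))

IsSubtreeOf-ωtree : {p : Parent n} {i : Fin n} {S : Subset n} →
  IsSubtreeOf (ωtree p) (opposite i) S → IsSubtreeOf p i (ωset S)
IsSubtreeOf-ωtree subtree j = ⇔.trans ∈-ωset (⇔.trans (subtree (opposite j)) (⇔.sym ⊑-ωtree))

IsAntichain-ωtree : {p : Parent n} {K : Subset n} → IsAntichain (ωtree p) K → IsAntichain p (ωset K)
IsAntichain-ωtree antichain a b a∈K b∈K a⊑b = opposite-injective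
  (antichain _ _ (Equivalence.to ∈-ωset a∈K) (Equivalence.to ∈-ωset b∈K) (Equivalence.to ⊑-ωtree a⊑b))

IsSubtreeUnion-ωtree : {p : Parent n} {K S : Subset n} →
  IsSubtreeUnion (ωtree p) K S → IsSubtreeUnion p (ωset K) (ωset S)
IsSubtreeUnion-ωtree {p = p} {K} {S} union x = mk⇔ to from
  where
  to : x Sub.∈ ωset S → ∃[ a ] (a Sub.∈ ωset K × x ⊑[ p ] a)
  to x∈S with ∃-opposite (Equivalence.to (union (opposite x)) (Equivalence.to ∈-ωset x∈S))
  ... | a , a∈K , x⊑a = a , Equivalence.from ∈-ωset a∈K , Equivalence.from ⊑-ωtree x⊑a
  from : ∃[ a ] (a Sub.∈ ωset K × x ⊑[ p ] a) → x Sub.∈ ωset S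
  from (a , a∈K , x⊑a) = Equivalence.from ∈-ωset
    (Equivalence.from (union (opposite x)) (opposite a , Equivalence.to ∈-ωset a∈K , Equivalence.to ⊑-ωtree x⊑a))

IsBTree-ωtree : {B : Subset n → Set} → IsωInvariant B → {p : Parent n} → IsBTree B p → IsBTree B (ωtree p)
IsBTree-ωtree {B = B} invariant (rooted , subtrees∈B , unions∉B) =
  IsRootedTree-ωtree rooted ,
  ∀-opposite (λ i S subtree → ωset-reflects (subtrees∈B i (ωset S) (IsSubtreeOf-ωtree subtree))) ,
  λ K S 2≤∣K∣ antichain union S∈B → unions∉B (ωset K) (ωset S)
    (subst (2 ≤_) (sym (∣ωset∣ K)) 2≤∣K∣) (IsAntichain-ωtree antichain) (IsSubtreeUnion-ωtree union)
    (invariant S S∈B)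
  where
  ωset-reflects : ∀ {S} → B (ωset S) → B S
  ωset-reflects {S} ωS∈B = subst B (ωset-involutive S) (invariant (ωset S) ωS∈B)

map-ωtree-↭ : {B : Subset n → Set} → IsωInvariant B → (L : List (Parent n)) → Unique L
  → (∀ T → (T ∈ L) ⇔ IsBTree B T) → map ωtree L ↭ L
map-ωtree-↭ invariant L L! L-spec = unique∧set⇒↭ (Uniqueₚ.map⁺ ωtree-injective L!) L! (mk⇔ to from)
  where
  ωtree-∈ : ∀ {T} → T ∈ L → ωtree T ∈ L
  ωtree-∈ {T} T∈L = Equivalence.from (L-spec (ωtree T)) (IsBTree-ωtree invariant (Equivalence.to (L-spec T) T∈L))
  to : ∀ {T} → T ∈ map ωtree L → T ∈ L
  to T∈ωL with Membershipₚ.∈-map⁻ ωtree T∈ωL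
  ... | T′ , T′∈L , refl = ωtree-∈ T′∈L
  from : ∀ {T} → T ∈ L → T ∈ map ωtree L
  from {T} T∈L = subst (_∈ map ωtree L) (ωtree-involutive T) (Membershipₚ.∈-map⁺ ωtree (ωtree-∈ T∈L))

anc-self-loop : {p : Parent n} {i : Fin n} → lookup p i ≡ just i → ∀ k → anc p k i ≡ just i
anc-self-loop loop zero              = refl
anc-self-loop {p = p} loop (suc k) = trans (cong (Maybe._>>= lookup p) (anc-self-loop loop k)) loop

no-self-loop : {p : Parent n} → IsRootedTree p → ∀ {i j} → lookup p i ≡ just j → i ≢ j
no-self-loop (r , root , _ , reaches-root) {i} loop refl with reaches-root i
... | k , anc≡r with trans (sym (anc-self-loop loop k)) anc≡r
... | refl with trans (sym root) loop
... | ()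

edge-count : ∀ {m} {p : Parent (suc m)} → IsRootedTree p → edgeSum p (λ _ _ → 1) ≡ m
edge-count {p = p} (r , root , unique-root , _) = ∑-ones-but-one _ r (cong (maybe′ (λ _ → 1) 0) root) non-root
  where
  non-root : ∀ i → i ≢ r → maybe′ (λ _ → 1) 0 (lookup p i) ≡ 1
  non-root i i≢r with lookup p i in is-root
  ... | just _  = refl
  ... | nothing = ⊥-elim (i≢r (unique-root i is-root))

atEdge : Parent n → (Fin n → Fin n → ℕ) → Fin n → ℕ
atEdge p f i = maybe′ (f i) 0 (lookup p i)

edgeSum-cong : (p : Parent n) {f g : Fin n → Fin n → ℕ} →
  (∀ i j → lookup p i ≡ just j → f i j ≡ g i j) → edgeSum p f ≡ edgeSum p g
edgeSum-cong p {f} {g} f≗g = ∑-cong on-edge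
  where
  on-edge : ∀ i → maybe′ (f i) 0 (lookup p i) ≡ maybe′ (g i) 0 (lookup p i)
  on-edge i with lookup p i in edge
  ... | just j  = f≗g i j edge
  ... | nothing = refl

edgeSum-+ : (p : Parent n) (f g : Fin n → Fin n → ℕ) →
  edgeSum p (λ i j → f i j + g i j) ≡ edgeSum p f + edgeSum p g
edgeSum-+ p f g = trans (∑-cong λ i → maybe-+ (lookup p i)) (∑-+ (atEdge p f) (atEdge p g))
  where
  maybe-+ : ∀ {i} (e : Maybe (Fin _)) → maybe′ (λ j → f i j + g i j) 0 e ≡ maybe′ (f i) 0 e + maybe′ (g i) 0 e
  maybe-+ (just j) = refl
  maybe-+ nothing  = refl

edgeSum-ωtree : (p : Parent n) (f : Fin n → Fin n → ℕ) →
  edgeSum (ωtree p) f ≡ edgeSum p (λ i j → f (opposite i) (opposite j))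
edgeSum-ωtree p f = begin
  ∑ (atEdge (ωtree p) f)                                               ≡⟨ ∑-opposite (atEdge (ωtree p) f) ⟨
  ∑ (λ i → maybe′ (f (opposite i)) 0 (lookup (ωtree p) (opposite i))) ≡⟨ ∑-cong relabel ⟩
  ∑ (λ i → maybe′ (f (opposite i) ∘ opposite) 0 (lookup p i))         ∎
  where
  open ≡-Reasoning
  relabel : ∀ i → maybe′ (f (opposite i)) 0 (lookup (ωtree p) (opposite i))
                ≡ maybe′ (f (opposite i) ∘ opposite) 0 (lookup p i)
  relabel i = trans (cong (maybe′ (f (opposite i)) 0) (lookup-ωtree p i)) (Maybeₚ.maybe′-map _ 0 opposite (lookup p i))

edgeSum-mirror : (p : Parent n) (f g : Fin n → Fin n → ℕ) →
  edgeSum p f + edgeSum (ωtree p) g ≡ edgeSum p (λ i j → f i j + g (opposite i) (opposite j))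
edgeSum-mirror p f g = trans (cong (edgeSum p f +_) (edgeSum-ωtree p g)) (sym (edgeSum-+ p f _))

steps-ωtree : (fuel : ℕ) (p : Parent n) (i : Fin n) → steps fuel (ωtree p) (opposite i) ≡ steps fuel p i
steps-ωtree zero       p i = refl
steps-ωtree (suc fuel) p i rewrite lookup-ωtree p i with lookup p i
... | nothing = refl
... | just j  = cong suc (steps-ωtree fuel p j)

depth-ωtree : (p : Parent n) → depth (ωtree p) ≡ depth p
depth-ωtree {n} p = trans (sym (max-opposite (dp (ωtree p)))) (max-cong (steps-ωtree n p))

height : Parent n → Fin n → ℕ
height p j = depth p ∸ dp p j

height-ωtree : (p : Parent n) (j : Fin n) → height (ωtree p) (opposite j) ≡ height p j
height-ωtree {n} p j = cong₂ _∸_ (depth-ωtree p) (steps-ωtree n p j)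

opposite-< : {i j : Fin n} → i Fin.< j → opposite j Fin.< opposite i
opposite-< {i = i} {j} i<j = subst₂ ℕ._<_ (sym (Finₚ.opposite-prop j)) (sym (Finₚ.opposite-prop i))
  (ℕₚ.∸-monoʳ-< (ℕ.s≤s i<j) (Finₚ.toℕ<n j))

isDes≡1 : {i j : Fin n} → j Fin.< i → isDes i j ≡ 1
isDes≡1 {i = i} {j} j<i with j Fin.<? i
... | yes _   = refl
... | no j≮i = ⊥-elim (j≮i j<i)

isDes≡0 : {i j : Fin n} → ¬ j Fin.< i → isDes i j ≡ 0
isDes≡0 {i = i} {j} j≮i with j Fin.<? i
... | yes j<i = ⊥-elim (j≮i j<i)
... | no _    = refl

isDes-mirror : {i j : Fin n} → i ≢ j → isDes i j + isDes (opposite i) (opposite j) ≡ 1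
isDes-mirror {i = i} {j} i≢j with Finₚ.<-cmp i j
... | tri< i<j _ j≮i = cong₂ _+_ (isDes≡0 j≮i) (isDes≡1 (opposite-< i<j))
... | tri≈ _ i≡j _   = ⊥-elim (i≢j i≡j)
... | tri> _ _ j<i   = cong₂ _+_ (isDes≡1 j<i) (isDes≡0 (Finₚ.<-asym (opposite-< j<i)))

module _ {m : ℕ} {p : Parent (suc m)} (rooted : IsRootedTree p) where

  des-+-des-ωtree : des p + des (ωtree p) ≡ m
  des-+-des-ωtree = begin
    des p + des (ωtree p)
      ≡⟨ edgeSum-mirror p isDes isDes ⟩
    edgeSum p (λ i j → isDes i j + isDes (opposite i) (opposite j))
      ≡⟨ edgeSum-cong p (λ i j edge → isDes-mirror (no-self-loop rooted edge)) ⟩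
    edgeSum p (λ _ _ → 1)
      ≡⟨ edge-count rooted ⟩
    m ∎
    where open ≡-Reasoning

  maj-+-maj-ωtree : maj p + maj (ωtree p) ≡ μ p
  maj-+-maj-ωtree = trans (edgeSum-mirror p _ _) (edgeSum-cong p on-edge)
    where
    open ≡-Reasoning
    on-edge : ∀ i j → lookup p i ≡ just j →
      isDes i j ℕ.* height p j + isDes (opposite i) (opposite j) ℕ.* height (ωtree p) (opposite j) ≡ height p j
    on-edge i j edge = begin
      isDes i j ℕ.* height p j + isDes (opposite i) (opposite j) ℕ.* height (ωtree p) (opposite j)
        ≡⟨ cong (λ h → isDes i j ℕ.* height p j + isDes (opposite i) (opposite j) ℕ.* h) (height-ωtree p j) ⟩
      isDes i j ℕ.* height p j + isDes (opposite i) (opposite j) ℕ.* height p j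
        ≡⟨ ℕₚ.*-distribʳ-+ (height p j) (isDes i j) _ ⟨
      (isDes i j + isDes (opposite i) (opposite j)) ℕ.* height p j
        ≡⟨ cong (ℕ._* height p j) (isDes-mirror (no-self-loop rooted edge)) ⟩
      1 ℕ.* height p j
        ≡⟨ ℕₚ.*-identityˡ (height p j) ⟩
      height p j ∎

μ-ωtree : (p : Parent n) → μ (ωtree p) ≡ μ p
μ-ωtree p = trans (edgeSum-ωtree p _) (edgeSum-cong p (λ _ j _ → height-ωtree p j))

module Monomials {c ℓ : Level} (R : CommutativeRing c ℓ) where
  open CommutativeRing R hiding (refl)
    renaming (sym to ≈-sym; trans to ≈-trans; setoid to ≈-setoid; _+_ to _⊕_)
  open Exp commutativeSemiring using (_^_; ^-homo-*; ^-distrib-*)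
  open CommutativeSemigroupProperties *-commutativeSemigroup using (interchange; x∙yz≈yx∙z)
  open import Relation.Binary.Reasoning.Setoid ≈-setoid

  pow≡^ : ∀ x k → pow R x k ≡ x ^ k
  pow≡^ x zero    = refl
  pow≡^ x (suc k) = cong (x *_) (pow≡^ x k)

  pow-+ : ∀ x a b → pow R x (a + b) ≈ pow R x a * pow R x b
  pow-+ x a b rewrite pow≡^ x (a + b) | pow≡^ x a | pow≡^ x b = ^-homo-* x a b

  pow-* : ∀ x y k → pow R (x * y) k ≈ pow R x k * pow R y k
  pow-* x y k rewrite pow≡^ (x * y) k | pow≡^ x k | pow≡^ y k = ^-distrib-* x y k

  pow-inverse : ∀ {x y} → x * y ≈ 1# → ∀ k → pow R x k * pow R y k ≈ 1#
  pow-inverse xy≈1 zero    = *-identityˡ 1#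
  pow-inverse {x} {y} xy≈1 (suc k) = begin
    (x * pow R x k) * (y * pow R y k) ≈⟨ interchange x (pow R x k) y (pow R y k) ⟩
    (x * y) * (pow R x k * pow R y k) ≈⟨ *-cong xy≈1 (pow-inverse xy≈1 k) ⟩
    1# * 1#                           ≈⟨ *-identityˡ 1# ⟩
    1#                                ∎

  pow-cancel : ∀ {x y} → x * y ≈ 1# → ∀ a b → pow R x (a + b) * pow R y b ≈ pow R x a
  pow-cancel {x} {y} xy≈1 a b = begin
    pow R x (a + b) * pow R y b           ≈⟨ *-congʳ (pow-+ x a b) ⟩
    (pow R x a * pow R x b) * pow R y b   ≈⟨ *-assoc _ _ _ ⟩
    pow R x a * (pow R x b * pow R y b)   ≈⟨ *-congˡ (pow-inverse xy≈1 b) ⟩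
    pow R x a * 1#                        ≈⟨ *-identityʳ _ ⟩
    pow R x a                             ∎

  monomial-mirror : ∀ {t t⁻¹ q q⁻¹} (u : Carrier) → t * t⁻¹ ≈ 1# → q * q⁻¹ ≈ 1# →
    ∀ d d′ e e′ {m M} → d + d′ ≡ m → e + e′ ≡ M →
    pow R t d * pow R q e * pow R u M ≈ pow R t m * (pow R t⁻¹ d′ * pow R q⁻¹ e′ * pow R (q * u) M)
  monomial-mirror {t} {t⁻¹} {q} {q⁻¹} u tt⁻¹≈1 qq⁻¹≈1 d d′ e e′ refl refl = ≈-sym (begin
    T * (T⁻¹ * Q⁻¹ * pow R (q * u) (e + e′))   ≈⟨ *-congˡ (*-congˡ (pow-* q u (e + e′))) ⟩
    T * (T⁻¹ * Q⁻¹ * (Q * U))                  ≈⟨ *-congˡ (*-assoc T⁻¹ Q⁻¹ (Q * U)) ⟩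
    T * (T⁻¹ * (Q⁻¹ * (Q * U)))                ≈⟨ *-assoc T T⁻¹ _ ⟨
    (T * T⁻¹) * (Q⁻¹ * (Q * U))                ≈⟨ *-congˡ (x∙yz≈yx∙z Q⁻¹ Q U) ⟩
    (T * T⁻¹) * ((Q * Q⁻¹) * U)                ≈⟨ *-cong (pow-cancel tt⁻¹≈1 d d′) (*-congʳ (pow-cancel qq⁻¹≈1 e e′)) ⟩
    pow R t d * (pow R q e * U)                ≈⟨ *-assoc _ _ _ ⟨
    pow R t d * pow R q e * U                  ∎)
    where
    T = pow R t (d + d′)
    T⁻¹ = pow R t⁻¹ d′
    Q = pow R q (e + e′)
    Q⁻¹ = pow R q⁻¹ e′
    U = pow R u (e + e′)

  monomial : ∀ {n} → Carrier → Carrier → Carrier → Parent n → Carrier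
  monomial t q u T = pow R t (des T) * pow R q (maj T) * pow R u (μ T)

  monomial-ωtree : ∀ {m} {t t⁻¹ q q⁻¹} (u : Carrier) → t * t⁻¹ ≈ 1# → q * q⁻¹ ≈ 1# →
    {T : Parent (suc m)} → IsRootedTree T →
    monomial t q u T ≈ pow R t m * monomial t⁻¹ q⁻¹ (q * u) (ωtree T)
  monomial-ωtree u tt⁻¹≈1 qq⁻¹≈1 {T} rooted rewrite μ-ωtree T =
    monomial-mirror u tt⁻¹≈1 qq⁻¹≈1 (des T) (des (ωtree T)) (maj T) (maj (ωtree T))
      (des-+-des-ωtree rooted) (maj-+-maj-ωtree rooted)

  hSum-as-foldr : ∀ {n} (Ts : List (Parent n)) t q u →
    hSum R Ts t q u ≡ foldr _⊕_ 0# (map (monomial t q u) Ts)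
  hSum-as-foldr []       t q u = refl
  hSum-as-foldr (T ∷ Ts) t q u = cong (_ ⊕_) (hSum-as-foldr Ts t q u)

  hSum-↭ : ∀ {n} {Ts Ts′ : List (Parent n)} t q u → Ts ↭ Ts′ → hSum R Ts t q u ≈ hSum R Ts′ t q u
  hSum-↭ {Ts = Ts} {Ts′} t q u Ts↭Ts′ = begin
    hSum R Ts t q u                         ≡⟨ hSum-as-foldr Ts t q u ⟩
    foldr _⊕_ 0# (map (monomial t q u) Ts)  ≈⟨ Fold.foldr-↭ +-commutativeMonoid (Permutationₚ.map⁺ (monomial t q u) Ts↭Ts′) ⟩
    foldr _⊕_ 0# (map (monomial t q u) Ts′) ≡⟨ hSum-as-foldr Ts′ t q u ⟨
    hSum R Ts′ t q u                        ∎

  hSum-ωtree : ∀ {m} {t t⁻¹ q q⁻¹} (u : Carrier) → t * t⁻¹ ≈ 1# → q * q⁻¹ ≈ 1# →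
    {Ts : List (Parent (suc m))} → All IsRootedTree Ts →
    hSum R Ts t q u ≈ pow R t m * hSum R (map ωtree Ts) t⁻¹ q⁻¹ (q * u)
  hSum-ωtree u tt⁻¹≈1 qq⁻¹≈1 []                   = ≈-sym (zeroʳ _)
  hSum-ωtree u tt⁻¹≈1 qq⁻¹≈1 (rooted ∷ allRooted) = ≈-trans
    (+-cong (monomial-ωtree u tt⁻¹≈1 qq⁻¹≈1 rooted) (hSum-ωtree u tt⁻¹≈1 qq⁻¹≈1 allRooted))
    (≈-sym (distribˡ _ _ _))

theorem4p9 : ∀ {c ℓ : Level} (n : ℕ) (B : Subset n → Set)
    → IsBuildingSet B → IsConnected B → IsωInvariant B
    → (L : List (Parent n)) → Unique L → (∀ T → (T ∈ L) ⇔ IsBTree B T)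
    → (R : CommutativeRing c ℓ)
    → let open CommutativeRing R in
    ∀ (t t⁻¹ q q⁻¹ u : Carrier) → t * t⁻¹ ≈ 1# → q * q⁻¹ ≈ 1#
    → hSum R L t q u ≈ pow R t (n ∸ 1) * hSum R L t⁻¹ q⁻¹ (q * u)
theorem4p9 zero B (nonempty , _) connected _ _ _ _ _ _ _ _ _ _ _ _ with nonempty Sub.⊤ connected
... | () , _
theorem4p9 (suc m) B _ _ invariant L L! L-spec R t t⁻¹ q q⁻¹ u tt⁻¹≈1 qq⁻¹≈1 = begin
  hSum R L t q u                                   ≈⟨ hSum-ωtree u tt⁻¹≈1 qq⁻¹≈1 (All.tabulate (proj₁ ∘ Equivalence.to (L-spec _))) ⟩
  pow R t m * hSum R (map ωtree L) t⁻¹ q⁻¹ (q * u) ≈⟨ *-congˡ (hSum-↭ t⁻¹ q⁻¹ (q * u) (map-ωtree-↭ invariant L L! L-spec)) ⟩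
  pow R t m * hSum R L t⁻¹ q⁻¹ (q * u)             ∎
  where
  open CommutativeRing R using (_*_; *-congˡ; setoid)
  open Monomials R
  open import Relation.Binary.Reasoning.Setoid setoid
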